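{- Let $q$ be an odd prime power, $m\ge0$, $c_0,\ldots,c_m\in\mathbb F_q$ with $c_m\ne0$, and $A(z)=c_0+\frac12\sum_{l=1}^m c_l(z^l+z^{ -l})$. Let $k,i\ge0$ and let $g_1,g_2\in\mathcal M(k)$ satisfy $g_1^*g_1\neq g_2^*g_2$. Then the quadratic form \[ h\longmapsto Q_{A,2}(hg_1)-Q_{A,2}(hg_2),\qquad h\in V_i, \] has polar rank at least $\max\{0,\,i-k-m+1\}$.
   Context: $\mathcal M(k)$ is the set of monic polynomials of degree $k$ in $\mathbb F_q[t]$, and $V_i=\{h\in\mathbb F_q[t]:\deg h\le i\}$. For a polynomial $a$ of degree $k$, $a^*(t)=t^ka(t^{ -1})$ is its reciprocal. For a polynomial $f\in\mathbb F_q[z]$, $Q_{A,2}(f)$ is the constant term of the Laurent polynomial $A(z)f(z)f(z^{ -1})$ (equivalently $Q_{A,2}(f)=\sum_{j=0}^m c_j\sum_i f_if_{i-j}$). The polar rank of a quadratic form is the rank of its polar bilinear form $(x,y)\mapsto Q(x+y)-Q(x)-Q(y)$. -}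

module Defs where

open import Level using (Level; _⊔_)
open import Algebra.Bundles using (CommutativeRing)
open import Data.Nat using (ℕ; zero; suc; _^_) renaming (_+_ to _+ℕ_; _*_ to _*ℕ_; _∸_ to _∸ℕ_)
open import Data.Nat.Primality using (Prime)
open import Data.Fin using (Fin; toℕ)
open import Data.Fin.Properties using () renaming (_≟_ to _≟ᶠ_)
open import Data.List using (List; []; _∷_; _++_; length; map; upTo; reverse)
open import Data.Vec using (Vec; toList; tabulate; zipWith)
open import Data.Product using (Σ; ∃; _×_)
open import Relation.Nullary using (¬_; yes; no)
open import Relation.Binary.PropositionalEquality using (_≡_)

OddPrimePower : ℕ → Set
OddPrimePower q = Σ ℕ λ p → Σ ℕ λ e → Prime p × (q ≡ p ^ suc e) × ¬ (Σ ℕ λ r → q ≡ 2 *ℕ r)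

module Over {c ℓ : Level} (R : CommutativeRing c ℓ) where
  open CommutativeRing R

  record IsFiniteFieldOfOrder (q : ℕ) : Set (c ⊔ ℓ) where
    field
      1≉0     : ¬ (1# ≈ 0#)
      inverse : ∀ x → ¬ (x ≈ 0#) → ∃ λ y → x * y ≈ 1#
      toFin   : Carrier → Fin q
      fromFin : Fin q → Carrier
      toFin-cong : ∀ {x y} → x ≈ y → toFin x ≡ toFin y
      from-to : ∀ x → fromFin (toFin x) ≈ x
      to-from : ∀ i → toFin (fromFin i) ≡ i

  sumTo : ℕ → (ℕ → Carrier) → Carrier
  sumTo zero    f = 0#
  sumTo (suc n) f = sumTo n f + f n

  sumFin : ∀ {n} → (Fin n → Carrier) → Carrier
  sumFin {zero}  f = 0#
  sumFin {suc n} f = f Fin.zero + sumFin (λ j → f (Fin.suc j))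

  -- polynomials in F[t] as coefficient lists (entry at index i = coefficient of t^i)
  Poly : Set c
  Poly = List Carrier

  coeff : Poly → ℕ → Carrier
  coeff []       n       = 0#
  coeff (a ∷ p)  zero    = a
  coeff (a ∷ p)  (suc n) = coeff p n

  _·_ : Poly → Poly → Poly
  p · r = map (λ n → sumTo (suc n) (λ a → coeff p a * coeff r (n ∸ℕ a)))
              (upTo (length p +ℕ length r))

  monic : ∀ {k} → Vec Carrier k → Poly
  monic g = toList g ++ (1# ∷ [])

  -- reciprocal a*(t) = t^k a(1/t) of a polynomial of degree k (coefficient list of length k+1)
  recip : Poly → Poly
  recip = reverse

  _≈ₚ_ : Poly → Poly → Set ℓ
  p ≈ₚ r = ∀ n → coeff p n ≈ coeff r n

  -- Q_{A,2}(f) = ∑_{j=0}^m c_j ∑_i f_i f_{i-j}   (written as ∑_i f_{i+j} f_i)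
  Q : ∀ {m} → (Fin (suc m) → Carrier) → Poly → Carrier
  Q cs f = sumFin (λ j → cs j * sumTo (length f) (λ i → coeff f (i +ℕ toℕ j) * coeff f i))

  -- the quadratic form h ↦ Q(h g1) - Q(h g2) on V_i (h given by coefficients h_0..h_i)
  Φ : ∀ {m i} → (Fin (suc m) → Carrier) → Poly → Poly → Vec Carrier (suc i) → Carrier
  Φ cs g₁ g₂ h = Q cs (toList h · g₁) - Q cs (toList h · g₂)

  polar : ∀ {n} → (Vec Carrier n → Carrier) → Vec Carrier n → Vec Carrier n → Carrier
  polar φ x y = φ (zipWith _+_ x y) - φ x - φ y

  basis : ∀ {n} → Fin n → Vec Carrier n
  basis a = tabulate λ b → case-eq a b
    where
      case-eq : ∀ {n} → Fin n → Fin n → Carrier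
      case-eq a b with a ≟ᶠ b
      ... | yes _ = 1#
      ... | no  _ = 0#

  gram : ∀ {n} → (Vec Carrier n → Vec Carrier n → Carrier) → Fin n → Fin n → Carrier
  gram B a b = B (basis a) (basis b)

  RankAtLeast : ∀ {n} → (Fin n → Fin n → Carrier) → ℕ → Set (c ⊔ ℓ)
  RankAtLeast {n} M r =
    Σ (Fin r → Fin n) λ rows →
      ∀ (λs : Fin r → Carrier) →
        (∀ b → sumFin (λ j → λs j * M (rows j) b) ≈ 0#) →
        ∀ j → λs j ≈ 0#

  PolarRankAtLeast : ∀ {n} → (Vec Carrier n → Carrier) → ℕ → Set (c ⊔ ℓ)
  PolarRankAtLeast φ r = RankAtLeast (gram (polar φ)) r

{-# OPTIONS --safe #-}
module Submission where

-- Write ρ_g(t) = Σ_p g_{p+t} g_p for the autocorrelation of g; for monic g of degree k it is the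
-- coefficient of t^{k+t} (and of t^{k-t}) in g* g, so the hypothesis says that D = ρ_{g₁} − ρ_{g₂}
-- is not identically zero. Let k′ ≤ k be the largest lag with D(k′) ≠ 0. In the basis 1, t, …, t^i
-- the Gram matrix of the polar form of h ↦ Q_{A,2}(h g₁) − Q_{A,2}(h g₂) has entry
-- Σ_j c_j (D(e+j) + D(e−j)) at position (a, a+e) whenever e ≥ m. It vanishes for e > m + k′, and
-- for e = m + k′ only j = m survives, leaving c_m D(k′), or 2 c_0 D(k′) when m = 0; this is nonzero
-- because q is odd. So the rows a = 0, …, i − m − k′ against the columns a + m + k′ form a triangular
-- system with nonzero pivots.

open import Defs
open import Level using (Level)
open import Algebra.Bundles using (CommutativeRing)
open import Data.Empty using (⊥-elim)
open import Data.Fin.Base using (Fin; zero; suc; toℕ; fromℕ; fromℕ<; inject₁; opposite)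
import Data.Fin.Properties as Fin
open import Data.List.Base using ([]; _∷_; _∷ʳ_; length; applyUpTo; upTo; reverse)
open import Data.List.Properties using (length-map; length-upTo; map-upTo; length-reverse; unfold-reverse; length-++)
open import Data.Nat.Base using (ℕ; zero; suc; _∸_; _≤_; _<_; z≤n; s≤s; ∣_-_∣)
  renaming (_+_ to _+ℕ_; _*_ to _*ℕ_)
import Data.Nat.Properties as ℕ
open import Data.Nat.DivMod using (_/_; _%_; m≡m%n+[m/n]*n; m%n<n)
open import Data.Nat.Tactic.RingSolver using (solve-∀)
open import Data.Product.Base using (∃-syntax; _×_; _,_)
open import Data.Sum.Base using (inj₁; inj₂)
open import Data.Vec.Base using (Vec; []; _∷_; lookup; toList; zipWith)
open import Data.Vec.Properties using (lookup∘tabulate; length-toList)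
open import Function.Base using (_∘_; _∋_)
open import Relation.Binary.Definitions using (Decidable)
open import Relation.Binary.PropositionalEquality as ≡ using (_≡_; _≢_)
open import Relation.Nullary using (¬_; Dec; yes; no)
open import Relation.Nullary.Decidable using (map′)

lastFailure : ∀ {p} {P : ℕ → Set p} → (∀ t → Dec (P t)) → ∀ N → (∀ t → N ≤ t → P t) →
              ¬ (∀ t → P t) → ∃[ t ] t < N × ¬ P t × (∀ u → t < u → P u)
lastFailure P? zero    P-from-N ¬all = ⊥-elim (¬all (λ t → P-from-N t z≤n))
lastFailure {P = P} P? (suc N) P-from-N ¬all with P? N
... | no ¬PN = N , ℕ.n<1+n N , ¬PN , P-from-N
... | yes PN with lastFailure P? N P-from-N′ ¬all
  where
  P-from-N′ : ∀ t → N ≤ t → P t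
  P-from-N′ t N≤t with ℕ.m≤n⇒m<n∨m≡n N≤t
  ... | inj₁ N<t    = P-from-N t N<t
  ... | inj₂ ≡.refl = PN
...   | t , t<N , ¬Pt , P-above-t = t , ℕ.m<n⇒m<1+n t<N , ¬Pt , P-above-t

m<o∸n⇒m+n<o : ∀ {m n o} → m < o ∸ n → m +ℕ n < o
m<o∸n⇒m+n<o {m} {zero}          m<o   = ≡.subst (_< _) (≡.sym (ℕ.+-identityʳ m)) m<o
m<o∸n⇒m+n<o {m} {suc n} {suc o} m<o∸n =
  ≡.subst (_< suc o) (≡.sym (ℕ.+-suc m n)) (s≤s (m<o∸n⇒m+n<o m<o∸n))

m+n∸[m∸o]≡o+n : ∀ {m o} n → o ≤ m → m +ℕ n ∸ (m ∸ o) ≡ o +ℕ n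
m+n∸[m∸o]≡o+n {m} {o} n o≤m =
  ≡.trans (ℕ.+-∸-comm n (ℕ.m∸n≤m m o)) (≡.cong (_+ℕ n) (ℕ.m∸[m∸n]≡n o≤m))

odd⇒≡1+[n/2]*2 : ∀ {n} → ¬ (∃[ r ] n ≡ 2 *ℕ r) → n ≡ 1 +ℕ (n / 2) *ℕ 2
odd⇒≡1+[n/2]*2 {n} n-odd with n % 2 | m≡m%n+[m/n]*n n 2 | m%n<n n 2
... | 0           | n≡ | _ = ⊥-elim (n-odd (n / 2 , ≡.trans n≡ (ℕ.*-comm (n / 2) 2)))
... | 1           | n≡ | _ = n≡
... | suc (suc _) | _  | s≤s (s≤s ())

module Polar {c ℓ : Level} (R : CommutativeRing c ℓ) where
  open CommutativeRing R hiding (zero)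
  open Over R
  open import Algebra.Properties.Ring ring
    using (-‿+-comm; xyx⁻¹≈y; x[y-z]≈xy-xz; +-identityʳ-unique; x∙y⁻¹≈ε⇒x≈y; x≈y⇒x∙y⁻¹≈ε)
  open import Algebra.Properties.CommutativeSemigroup +-commutativeSemigroup using (interchange)
  open import Algebra.Properties.Semiring.Sum semiring
    using (sum; sum-cong-≋; ∑-distrib-+; sum-replicate-zero; sum-init-last)
  open import Relation.Binary.Reasoning.Setoid setoid

  +-−-interchange : ∀ a b c d → (a + b) - (c + d) ≈ (a - c) + (b - d)
  +-−-interchange a b c d = trans (+-congˡ (sym (-‿+-comm c d))) (interchange a b (- c) (- d))

  −-interchange : ∀ a b c d → (a - b) - (c - d) ≈ (a - c) - (b - d)
  −-interchange a b c d = trans (+-−-interchange a (- b) c (- d)) (+-congˡ (-‿+-comm b (- d)))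

  +-+-−-cancel : ∀ a b c → a + b + c - a - b ≈ c
  +-+-−-cancel a b c =
    trans (+-congʳ (trans (+-congʳ (+-assoc a b c)) (xyx⁻¹≈y a (b + c)))) (xyx⁻¹≈y b c)

  +-*-expand : ∀ a b c d → (a + b) * (c + d) ≈ (a * c + b * d) + (a * d + b * c)
  +-*-expand a b c d = begin
    (a + b) * (c + d)                  ≈⟨ distribʳ (c + d) a b ⟩
    a * (c + d) + b * (c + d)          ≈⟨ +-cong (distribˡ a c d) (trans (distribˡ b c d) (+-comm _ _)) ⟩
    (a * c + a * d) + (b * d + b * c)  ≈⟨ interchange _ _ _ _ ⟩
    (a * c + b * d) + (a * d + b * c)  ∎

  x≈0⇒x*y≈0 : ∀ {x} y → x ≈ 0# → x * y ≈ 0#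
  x≈0⇒x*y≈0 y x≈0 = trans (*-congʳ x≈0) (zeroˡ y)

  y≈0⇒x*y≈0 : ∀ x {y} → y ≈ 0# → x * y ≈ 0#
  y≈0⇒x*y≈0 x y≈0 = trans (*-congˡ y≈0) (zeroʳ x)

  -- Finite sums

  sumTo-cong : ∀ N {f g : ℕ → Carrier} → (∀ n → n < N → f n ≈ g n) → sumTo N f ≈ sumTo N g
  sumTo-cong zero    f≈g = refl
  sumTo-cong (suc N) f≈g =
    +-cong (sumTo-cong N (λ n n<N → f≈g n (ℕ.m<n⇒m<1+n n<N))) (f≈g N (ℕ.n<1+n N))

  sumTo-zero : ∀ N {f : ℕ → Carrier} → (∀ n → n < N → f n ≈ 0#) → sumTo N f ≈ 0#
  sumTo-zero zero    f≈0 = refl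
  sumTo-zero (suc N) f≈0 =
    trans (+-cong (sumTo-zero N (λ n n<N → f≈0 n (ℕ.m<n⇒m<1+n n<N))) (f≈0 N (ℕ.n<1+n N))) (+-identityʳ 0#)

  sumTo-+ : ∀ N (f g : ℕ → Carrier) → sumTo N (λ n → f n + g n) ≈ sumTo N f + sumTo N g
  sumTo-+ zero    f g = sym (+-identityʳ 0#)
  sumTo-+ (suc N) f g = trans (+-congʳ (sumTo-+ N f g)) (interchange _ _ _ _)

  sumTo-split : ∀ s N (f : ℕ → Carrier) → sumTo (s +ℕ N) f ≈ sumTo s f + sumTo N (λ p → f (s +ℕ p))
  sumTo-split s zero    f rewrite ℕ.+-identityʳ s = sym (+-identityʳ _)
  sumTo-split s (suc N) f rewrite ℕ.+-suc s N = trans (+-congʳ (sumTo-split s N f)) (+-assoc _ _ _)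

  sumTo-dropLeading : ∀ s N (f : ℕ → Carrier) → (∀ n → n < s → f n ≈ 0#) →
                      sumTo (s +ℕ N) f ≈ sumTo N (λ p → f (s +ℕ p))
  sumTo-dropLeading s N f f≈0 =
    trans (sumTo-split s N f) (trans (+-congʳ (sumTo-zero s f≈0)) (+-identityˡ _))

  sumTo-extend : ∀ {K M} (f : ℕ → Carrier) → K ≤ M → (∀ n → K ≤ n → f n ≈ 0#) →
                 sumTo M f ≈ sumTo K f
  sumTo-extend {K} {M} f K≤M f≈0 = begin
    sumTo M f
      ≡⟨ ≡.cong (λ N → sumTo N f) (≡.sym (ℕ.m+[n∸m]≡n K≤M)) ⟩
    sumTo (K +ℕ (M ∸ K)) f
      ≈⟨ sumTo-split K (M ∸ K) f ⟩
    sumTo K f + sumTo (M ∸ K) (λ p → f (K +ℕ p))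
      ≈⟨ +-congˡ (sumTo-zero (M ∸ K) (λ p _ → f≈0 (K +ℕ p) (ℕ.m≤m+n K p))) ⟩
    sumTo K f + 0#
      ≈⟨ +-identityʳ _ ⟩
    sumTo K f ∎

  sumTo-front : ∀ N (f : ℕ → Carrier) → sumTo (suc N) f ≈ f 0 + sumTo N (λ p → f (suc p))
  sumTo-front N f = trans (sumTo-split 1 N f) (+-congʳ (+-identityˡ (f 0)))

  sumTo-reverse : ∀ N (f : ℕ → Carrier) → sumTo N f ≈ sumTo N (λ a → f (N ∸ suc a))
  sumTo-reverse zero    f = refl
  sumTo-reverse (suc N) f = begin
    sumTo N f + f N                          ≈⟨ +-congʳ (sumTo-reverse N f) ⟩
    sumTo N (λ a → f (N ∸ suc a)) + f N      ≈⟨ +-comm _ _ ⟩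
    f N + sumTo N (λ a → f (N ∸ suc a))      ≈⟨ sumTo-front N (λ a → f (suc N ∸ suc a)) ⟨
    sumTo (suc N) (λ a → f (suc N ∸ suc a))  ∎

  sumTo-single : ∀ N {f : ℕ → Carrier} t → t < N → (∀ n → n < N → n ≢ t → f n ≈ 0#) →
                 sumTo N f ≈ f t
  sumTo-single (suc N) {f} t t<1+N f≈0 with ℕ.m≤n⇒m<n∨m≡n (ℕ.≤-pred t<1+N)
  ... | inj₁ t<N    = trans (+-cong (sumTo-single N t t<N (λ n n<N → f≈0 n (ℕ.m<n⇒m<1+n n<N)))
                                    (f≈0 N (ℕ.n<1+n N) (ℕ.>⇒≢ t<N)))
                            (+-identityʳ (f t))
  ... | inj₂ ≡.refl = trans (+-congʳ (sumTo-zero N (λ n n<N → f≈0 n (ℕ.m<n⇒m<1+n n<N) (ℕ.<⇒≢ n<N))))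
                            (+-identityˡ (f t))

  sumFin≡sum : ∀ {n} (f : Fin n → Carrier) → sumFin f ≡ sum f
  sumFin≡sum {zero}  f = ≡.refl
  sumFin≡sum {suc n} f = ≡.cong (f zero +_) (sumFin≡sum (f ∘ suc))

  ∑-zero : ∀ {n} {f : Fin n → Carrier} → (∀ j → f j ≈ 0#) → sum f ≈ 0#
  ∑-zero {n} f≈0 = trans (sum-cong-≋ f≈0) (sum-replicate-zero n)

  sumFin-zero : ∀ {n} {f : Fin n → Carrier} → (∀ j → f j ≈ 0#) → sumFin f ≈ 0#
  sumFin-zero {f = f} f≈0 = trans (reflexive (sumFin≡sum f)) (∑-zero f≈0)

  ∑-distrib-− : ∀ {n} (f g : Fin n → Carrier) → sum (λ j → f j - g j) ≈ sum f - sum g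
  ∑-distrib-− {zero}  f g = sym (-‿inverseʳ 0#)
  ∑-distrib-− {suc n} f g =
    trans (+-congˡ (∑-distrib-− (f ∘ suc) (g ∘ suc))) (sym (+-−-interchange _ _ _ _))

  -- Coefficients of products

  shift : ℕ → (ℕ → Carrier) → ℕ → Carrier
  shift zero    u n       = u n
  shift (suc a) u zero    = 0#
  shift (suc a) u (suc n) = shift a u n

  shift-< : ∀ {a n} (u : ℕ → Carrier) → n < a → shift a u n ≡ 0#
  shift-< {suc a} {zero}  u _         = ≡.refl
  shift-< {suc a} {suc n} u (s≤s n<a) = shift-< u n<a

  shift-+ : ∀ a (u : ℕ → Carrier) n → shift a u (a +ℕ n) ≡ u n
  shift-+ zero    u n = ≡.refl
  shift-+ (suc a) u n = shift-+ a u n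

  shift-∸ : ∀ {a n} (u : ℕ → Carrier) → a ≤ n → shift a u n ≡ u (n ∸ a)
  shift-∸ {a} u a≤n = ≡.trans (≡.cong (shift a u) (≡.sym (ℕ.m+[n∸m]≡n a≤n))) (shift-+ a u _)

  shift-shift : ∀ a b (u : ℕ → Carrier) n → shift a (shift b u) n ≡ shift (a +ℕ b) u n
  shift-shift zero    b u n       = ≡.refl
  shift-shift (suc a) b u zero    = ≡.refl
  shift-shift (suc a) b u (suc n) = shift-shift a b u n

  coeff-beyond : ∀ (p : Poly) {n} → length p ≤ n → coeff p n ≡ 0#
  coeff-beyond []      _         = ≡.refl
  coeff-beyond (x ∷ p) (s≤s p≤n) = coeff-beyond p p≤n

  coeff-applyUpTo : ∀ (f : ℕ → Carrier) {L n} → n < L → coeff (applyUpTo f L) n ≡ f n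
  coeff-applyUpTo f {suc L} {zero}  _         = ≡.refl
  coeff-applyUpTo f {suc L} {suc n} (s≤s n<L) = coeff-applyUpTo (f ∘ suc) n<L

  length-· : ∀ p r → length (p · r) ≡ length p +ℕ length r
  length-· p r = ≡.trans (length-map _ (upTo (length p +ℕ length r))) (length-upTo _)

  coeff-· : ∀ p r n → coeff (p · r) n ≈ sumTo (suc n) (λ a → coeff p a * coeff r (n ∸ a))
  coeff-· p r n with n ℕ.<? length p +ℕ length r
  ... | yes n<p+r = reflexive (≡.trans (≡.cong (λ ps → coeff ps n) (map-upTo _ (length p +ℕ length r)))
                                       (coeff-applyUpTo _ n<p+r))
  ... | no n≮p+r  = begin
    coeff (p · r) n ≡⟨ coeff-beyond (p · r) (≡.subst (_≤ n) (≡.sym (length-· p r)) p+r≤n) ⟩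
    0#              ≈⟨ sumTo-zero (suc n) (λ a _ → term≈0 a) ⟨
    sumTo (suc n) (λ a → coeff p a * coeff r (n ∸ a)) ∎
    where
    p+r≤n : length p +ℕ length r ≤ n
    p+r≤n = ℕ.≮⇒≥ n≮p+r
    term≈0 : ∀ a → coeff p a * coeff r (n ∸ a) ≈ 0#
    term≈0 a with a ℕ.<? length p
    ... | yes a<p = y≈0⇒x*y≈0 (coeff p a) (reflexive (coeff-beyond r r≤n∸a))
      where
      r+a≤n : length r +ℕ a ≤ n
      r+a≤n = ℕ.≤-trans (ℕ.≤-trans (ℕ.+-monoʳ-≤ (length r) (ℕ.<⇒≤ a<p))
                                   (ℕ.≤-reflexive (ℕ.+-comm (length r) (length p))))
                        p+r≤n
      r≤n∸a : length r ≤ n ∸ a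
      r≤n∸a = ℕ.m+n≤o⇒m≤o∸n (length r) r+a≤n
    ... | no a≮p  = x≈0⇒x*y≈0 (coeff r (n ∸ a)) (reflexive (coeff-beyond p (ℕ.≮⇒≥ a≮p)))

  ·-distribʳ-coeff : ∀ p q r G → (∀ a → coeff p a ≈ coeff q a + coeff r a) →
                     ∀ n → coeff (p · G) n ≈ coeff (q · G) n + coeff (r · G) n
  ·-distribʳ-coeff p q r G p≈q+r n = begin
    coeff (p · G) n
      ≈⟨ coeff-· p G n ⟩
    sumTo (suc n) (λ a → coeff p a * γ (n ∸ a))
      ≈⟨ sumTo-cong (suc n) (λ a _ → trans (*-congʳ (p≈q+r a)) (distribʳ _ _ _)) ⟩
    sumTo (suc n) (λ a → coeff q a * γ (n ∸ a) + coeff r a * γ (n ∸ a))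
      ≈⟨ sumTo-+ (suc n) _ _ ⟩
    sumTo (suc n) (λ a → coeff q a * γ (n ∸ a)) + sumTo (suc n) (λ a → coeff r a * γ (n ∸ a))
      ≈⟨ +-cong (coeff-· q G n) (coeff-· r G n) ⟨
    coeff (q · G) n + coeff (r · G) n ∎
    where
    γ = coeff G

  coeff-zipWith : ∀ {N} (x y : Vec Carrier N) n →
                  coeff (toList (zipWith _+_ x y)) n ≈ coeff (toList x) n + coeff (toList y) n
  coeff-zipWith []      []      n       = sym (+-identityʳ 0#)
  coeff-zipWith (a ∷ x) (b ∷ y) zero    = refl
  coeff-zipWith (a ∷ x) (b ∷ y) (suc n) = coeff-zipWith x y n

  coeff-toList : ∀ {N} (v : Vec Carrier N) {n} (n<N : n < N) → coeff (toList v) n ≡ lookup v (fromℕ< n<N)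
  coeff-toList (x ∷ v) {zero}  _         = ≡.refl
  coeff-toList (x ∷ v) {suc n} (s≤s n<N) = coeff-toList v n<N

  -- basis is built from a local helper that cannot be named here; abstracting the decision
  -- a ≟ b in the type of lookup∘tabulate exposes it.
  lookup-basis-≡ : ∀ {n} (a : Fin n) → lookup (basis a) a ≡ 1#
  lookup-basis-≡ a with a Fin.≟ a | (lookup (basis a) a ≡ _ ∋ lookup∘tabulate _ a)
  ... | yes _   | eq = eq
  ... | no a≢a  | _  = ⊥-elim (a≢a ≡.refl)

  lookup-basis-≢ : ∀ {n} {a b : Fin n} → a ≢ b → lookup (basis a) b ≡ 0#
  lookup-basis-≢ {a = a} {b} a≢b with a Fin.≟ b | (lookup (basis a) b ≡ _ ∋ lookup∘tabulate _ b)
  ... | yes a≡b | _  = ⊥-elim (a≢b a≡b)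
  ... | no _    | eq = eq

  coeff-basis-≡ : ∀ {N} (a : Fin N) → coeff (toList (basis a)) (toℕ a) ≡ 1#
  coeff-basis-≡ a = ≡.trans (coeff-toList (basis a) (Fin.toℕ<n a))
                            (≡.trans (≡.cong (lookup (basis a)) (Fin.fromℕ<-toℕ a _)) (lookup-basis-≡ a))

  coeff-basis-≢ : ∀ {N} (a : Fin N) {n} → n ≢ toℕ a → coeff (toList (basis a)) n ≡ 0#
  coeff-basis-≢ {N} a {n} n≢a with n ℕ.<? N
  ... | yes n<N = ≡.trans (coeff-toList (basis a) n<N) (lookup-basis-≢ a≢n)
    where
    a≢n : a ≢ fromℕ< n<N
    a≢n a≡n = n≢a (≡.trans (≡.sym (Fin.toℕ-fromℕ< n<N)) (≡.cong toℕ (≡.sym a≡n)))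
  ... | no n≮N  =
    coeff-beyond (toList (basis a)) (≡.subst (_≤ n) (≡.sym (length-toList (basis a))) (ℕ.≮⇒≥ n≮N))

  coeff-basis-· : ∀ {N} (a : Fin N) G n → coeff (toList (basis a) · G) n ≈ shift (toℕ a) (coeff G) n
  coeff-basis-· a G n = trans (coeff-· (toList (basis a)) G n) (by-position (toℕ a ℕ.≤? n))
    where
    e = coeff (toList (basis a))
    γ = coeff G
    off-position : ∀ b → b ≢ toℕ a → e b * γ (n ∸ b) ≈ 0#
    off-position b b≢a = x≈0⇒x*y≈0 (γ (n ∸ b)) (reflexive (coeff-basis-≢ a b≢a))
    by-position : Dec (toℕ a ≤ n) → sumTo (suc n) (λ b → e b * γ (n ∸ b)) ≈ shift (toℕ a) γ n
    by-position (yes a≤n) = begin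
      sumTo (suc n) (λ b → e b * γ (n ∸ b))
        ≈⟨ sumTo-single (suc n) (toℕ a) (s≤s a≤n) (λ b _ → off-position b) ⟩
      e (toℕ a) * γ (n ∸ toℕ a)
        ≈⟨ trans (*-congʳ (reflexive (coeff-basis-≡ a))) (*-identityˡ _) ⟩
      γ (n ∸ toℕ a)
        ≡⟨ ≡.sym (shift-∸ γ a≤n) ⟩
      shift (toℕ a) γ n ∎
    by-position (no a≰n) = trans (sumTo-zero (suc n) (λ b b<1+n → off-position b (b≢a b<1+n)))
                                 (reflexive (≡.sym (shift-< γ (ℕ.≰⇒> a≰n))))
      where
      b≢a : ∀ {b} → b < suc n → b ≢ toℕ a
      b≢a b<1+n b≡a = a≰n (≡.subst (_≤ n) b≡a (ℕ.≤-pred b<1+n))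

  coeff-∷ʳ-< : ∀ (p : Poly) x {a} → a < length p → coeff (p ∷ʳ x) a ≡ coeff p a
  coeff-∷ʳ-< (y ∷ p) x {zero}  _         = ≡.refl
  coeff-∷ʳ-< (y ∷ p) x {suc a} (s≤s a<p) = coeff-∷ʳ-< p x a<p

  coeff-∷ʳ-length : ∀ (p : Poly) x → coeff (p ∷ʳ x) (length p) ≡ x
  coeff-∷ʳ-length []      x = ≡.refl
  coeff-∷ʳ-length (y ∷ p) x = coeff-∷ʳ-length p x

  coeff-reverse : ∀ (p : Poly) {a} → a < length p → coeff (reverse p) a ≡ coeff p (length p ∸ suc a)
  coeff-reverse (x ∷ p) {a} a<1+p rewrite unfold-reverse x p with ℕ.m≤n⇒m<n∨m≡n (ℕ.≤-pred a<1+p)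
  ... | inj₁ a<p    =
    ≡.trans (coeff-∷ʳ-< (reverse p) x (≡.subst (a <_) (≡.sym (length-reverse p)) a<p))
            (≡.trans (coeff-reverse p a<p) (≡.cong (coeff (x ∷ p)) (≡.sym (ℕ.+-∸-assoc 1 a<p))))
  ... | inj₂ ≡.refl =
    ≡.trans (≡.cong (coeff (reverse p ∷ʳ x)) (≡.sym (length-reverse p)))
            (≡.trans (coeff-∷ʳ-length (reverse p) x) (≡.cong (coeff (x ∷ p)) (≡.sym (ℕ.n∸n≡0 a))))

  coeff-reverse-≤ : ∀ (p : Poly) {k a} → length p ≡ suc k → a ≤ k → coeff (reverse p) a ≡ coeff p (k ∸ a)
  coeff-reverse-≤ p {k} {a} p≡1+k a≤k =
    ≡.trans (coeff-reverse p (≡.subst (a <_) (≡.sym p≡1+k) (s≤s a≤k)))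
            (≡.cong (λ K → coeff p (K ∸ suc a)) p≡1+k)

  length-monic : ∀ {k} (g : Vec Carrier k) → length (monic g) ≡ suc k
  length-monic {k} g =
    ≡.trans (length-++ (toList g)) (≡.trans (≡.cong (_+ℕ 1) (length-toList g)) (ℕ.+-comm k 1))

  -- Autocorrelation

  dot : ℕ → (ℕ → Carrier) → (ℕ → Carrier) → Carrier
  dot L u v = sumTo L (λ n → u n * v n)

  crossCorr : ℕ → ℕ → (ℕ → Carrier) → (ℕ → Carrier) → Carrier
  crossCorr L j u v = sumTo L (λ n → u (n +ℕ j) * v n)

  autocorr : Poly → ℕ → Carrier
  autocorr G t = crossCorr (length G) t (coeff G) (coeff G)

  dot-comm : ∀ L (u v : ℕ → Carrier) → dot L u v ≈ dot L v u
  dot-comm L u v = sumTo-cong L (λ n _ → *-comm (u n) (v n))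

  crossCorr-cong : ∀ L j {u u′ v v′ : ℕ → Carrier} → (∀ n → u n ≈ u′ n) → (∀ n → v n ≈ v′ n) →
                   crossCorr L j u v ≈ crossCorr L j u′ v′
  crossCorr-cong L j u≈u′ v≈v′ = sumTo-cong L (λ n _ → *-cong (u≈u′ (n +ℕ j)) (v≈v′ n))

  crossCorr-+ : ∀ L j (u v : ℕ → Carrier) →
                crossCorr L j (λ n → u n + v n) (λ n → u n + v n)
                ≈ (crossCorr L j u u + crossCorr L j v v) + (crossCorr L j u v + crossCorr L j v u)
  crossCorr-+ L j u v = trans (sumTo-cong L (λ n _ → +-*-expand _ _ _ _))
                              (trans (sumTo-+ L _ _) (+-cong (sumTo-+ L _ _) (sumTo-+ L _ _)))

  crossCorr-shift : ∀ L j b (u v : ℕ → Carrier) →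
                    crossCorr L j u (shift b v) ≈ dot (j +ℕ L) u (shift (j +ℕ b) v)
  crossCorr-shift L j b u v = sym (begin
    dot (j +ℕ L) u (shift (j +ℕ b) v)
      ≈⟨ sumTo-cong (j +ℕ L) (λ n _ → *-congˡ (reflexive (≡.sym (shift-shift j b v n)))) ⟩
    dot (j +ℕ L) u (shift j v′)
      ≈⟨ sumTo-dropLeading j L _ (λ n n<j → y≈0⇒x*y≈0 (u n) (reflexive (shift-< v′ n<j))) ⟩
    sumTo L (λ p → u (j +ℕ p) * shift j v′ (j +ℕ p))
      ≈⟨ sumTo-cong L (λ p _ → *-cong (reflexive (≡.cong u (ℕ.+-comm j p))) (reflexive (shift-+ j v′ p))) ⟩
    crossCorr L j u v′ ∎)
    where
    v′ = shift b v

  autocorr-beyond : ∀ G {t} → length G ≤ t → autocorr G t ≈ 0#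
  autocorr-beyond G {t} G≤t = sumTo-zero (length G) (λ n _ →
    x≈0⇒x*y≈0 (coeff G n) (reflexive (coeff-beyond G (ℕ.≤-trans G≤t (ℕ.m≤n+m t n)))))

  dot-shift : ∀ G {a b t L} → a +ℕ t ≡ b → b +ℕ length G ≤ L →
              dot L (shift a (coeff G)) (shift b (coeff G)) ≈ autocorr G t
  dot-shift G {a} {t = t} {L} ≡.refl b+G≤L = begin
    dot L (shift a γ) (shift b γ)
      ≡⟨ ≡.cong (λ N → dot N (shift a γ) (shift b γ)) (≡.sym (ℕ.m+[n∸m]≡n (ℕ.m+n≤o⇒m≤o b b+G≤L))) ⟩
    dot (b +ℕ (L ∸ b)) (shift a γ) (shift b γ)
      ≈⟨ sumTo-dropLeading b (L ∸ b) _ (λ n n<b → y≈0⇒x*y≈0 (shift a γ n) (reflexive (shift-< γ n<b))) ⟩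
    sumTo (L ∸ b) (λ p → shift a γ (b +ℕ p) * shift b γ (b +ℕ p))
      ≈⟨ sumTo-cong (L ∸ b) (λ p _ → *-cong (reflexive (left p)) (reflexive (shift-+ b γ p))) ⟩
    sumTo (L ∸ b) (λ p → γ (p +ℕ t) * γ p)
      ≈⟨ sumTo-extend _ G≤L∸b (λ p G≤p → x≈0⇒x*y≈0 (γ p) (γ-beyond (ℕ.≤-trans G≤p (ℕ.m≤m+n p t)))) ⟩
    autocorr G t ∎
    where
    γ = coeff G
    b = a +ℕ t
    γ-beyond : ∀ {p} → length G ≤ p → γ p ≈ 0#
    γ-beyond G≤p = reflexive (coeff-beyond G G≤p)
    left : ∀ p → shift a γ (b +ℕ p) ≡ γ (p +ℕ t)
    left p = ≡.trans (≡.cong (shift a γ) (ℕ.+-assoc a t p))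
                     (≡.trans (shift-+ a γ (t +ℕ p)) (≡.cong γ (ℕ.+-comm t p)))
    G≤L∸b : length G ≤ L ∸ b
    G≤L∸b = ℕ.m+n≤o⇒m≤o∸n (length G) (≡.subst (_≤ L) (ℕ.+-comm b (length G)) b+G≤L)

  coeff-recip-·-above : ∀ G {k t n} → length G ≡ suc k → k +ℕ t ≡ n → coeff (recip G · G) n ≈ autocorr G t
  coeff-recip-·-above G {k} {t} G≡1+k ≡.refl = begin
    coeff (reverse G · G) (k +ℕ t)
      ≈⟨ coeff-· (reverse G) G (k +ℕ t) ⟩
    sumTo (suc (k +ℕ t)) (λ a → coeff (reverse G) a * γ (k +ℕ t ∸ a))
      ≈⟨ sumTo-extend _ (s≤s (ℕ.m≤m+n k t)) (λ a k<a → x≈0⇒x*y≈0 (γ (k +ℕ t ∸ a)) (reverse≈0 k<a)) ⟩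
    sumTo (suc k) (λ a → coeff (reverse G) a * γ (k +ℕ t ∸ a))
      ≈⟨ sumTo-cong (suc k) (λ a a<1+k → *-congʳ (reflexive (coeff-reverse-≤ G G≡1+k (ℕ.≤-pred a<1+k)))) ⟩
    sumTo (suc k) (λ a → γ (k ∸ a) * γ (k +ℕ t ∸ a))
      ≈⟨ sumTo-reverse (suc k) _ ⟩
    sumTo (suc k) (λ a → γ (k ∸ (k ∸ a)) * γ (k +ℕ t ∸ (k ∸ a)))
      ≈⟨ sumTo-cong (suc k) (λ a a<1+k → trans (*-comm _ _) (reflexive (reflected (ℕ.≤-pred a<1+k)))) ⟩
    sumTo (suc k) (λ a → γ (a +ℕ t) * γ a)
      ≡⟨ ≡.cong (λ K → sumTo K (λ a → γ (a +ℕ t) * γ a)) (≡.sym G≡1+k) ⟩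
    autocorr G t ∎
    where
    γ = coeff G
    reverse≈0 : ∀ {a} → suc k ≤ a → coeff (reverse G) a ≈ 0#
    reverse≈0 k<a =
      reflexive (coeff-beyond (reverse G) (≡.subst (_≤ _) (≡.sym (≡.trans (length-reverse G) G≡1+k)) k<a))
    reflected : ∀ {a} → a ≤ k → γ (k +ℕ t ∸ (k ∸ a)) * γ (k ∸ (k ∸ a)) ≡ γ (a +ℕ t) * γ a
    reflected a≤k = ≡.cong₂ (λ x y → γ x * γ y) (m+n∸[m∸o]≡o+n t a≤k) (ℕ.m∸[m∸n]≡n a≤k)

  coeff-recip-·-below : ∀ G {k t n} → length G ≡ suc k → n +ℕ t ≡ k → coeff (recip G · G) n ≈ autocorr G t
  coeff-recip-·-below G {t = t} {n} G≡1+k ≡.refl = begin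
    coeff (reverse G · G) n
      ≈⟨ coeff-· (reverse G) G n ⟩
    sumTo (suc n) (λ a → coeff (reverse G) a * γ (n ∸ a))
      ≈⟨ sumTo-cong (suc n) (λ a a<1+n → *-congʳ (reflexive (coeff-reverse-≤ G G≡1+k (a≤n+t a<1+n)))) ⟩
    sumTo (suc n) (λ a → γ (n +ℕ t ∸ a) * γ (n ∸ a))
      ≈⟨ sumTo-reverse (suc n) _ ⟩
    sumTo (suc n) (λ a → γ (n +ℕ t ∸ (n ∸ a)) * γ (n ∸ (n ∸ a)))
      ≈⟨ sumTo-cong (suc n) (λ a a<1+n → reflexive (reflected (ℕ.≤-pred a<1+n))) ⟩
    sumTo (suc n) (λ a → γ (a +ℕ t) * γ a)
      ≈⟨ sumTo-extend _ 1+n≤G (λ a n<a → x≈0⇒x*y≈0 (γ a) (reflexive (coeff-beyond G (G≤a+t n<a)))) ⟨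
    autocorr G t ∎
    where
    γ = coeff G
    a≤n+t : ∀ {a} → a < suc n → a ≤ n +ℕ t
    a≤n+t a<1+n = ℕ.≤-trans (ℕ.≤-pred a<1+n) (ℕ.m≤m+n n t)
    1+n≤G : suc n ≤ length G
    1+n≤G = ≡.subst (suc n ≤_) (≡.sym G≡1+k) (s≤s (ℕ.m≤m+n n t))
    G≤a+t : ∀ {a} → suc n ≤ a → length G ≤ a +ℕ t
    G≤a+t n<a = ≡.subst (_≤ _) (≡.sym G≡1+k) (ℕ.+-monoˡ-≤ t n<a)
    reflected : ∀ {a} → a ≤ n → γ (n +ℕ t ∸ (n ∸ a)) * γ (n ∸ (n ∸ a)) ≡ γ (a +ℕ t) * γ a
    reflected a≤n = ≡.cong₂ (λ x y → γ x * γ y) (m+n∸[m∸o]≡o+n t a≤n) (ℕ.m∸[m∸n]≡n a≤n)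

  coeff-recip-· : ∀ G {k} → length G ≡ suc k → ∀ n → coeff (recip G · G) n ≈ autocorr G ∣ n - k ∣
  coeff-recip-· G {k} G≡1+k n with ℕ.≤-total k n
  ... | inj₁ k≤n = trans (coeff-recip-·-above G G≡1+k (ℕ.m+[n∸m]≡n k≤n))
                         (reflexive (≡.cong (autocorr G) (≡.sym (ℕ.m≤n⇒∣n-m∣≡n∸m k≤n))))
  ... | inj₂ n≤k = trans (coeff-recip-·-below G G≡1+k (ℕ.m+[n∸m]≡n n≤k))
                         (reflexive (≡.cong (autocorr G) (≡.sym (ℕ.m≤n⇒∣m-n∣≡n∸m n≤k))))

  recip-·-≈ₚ : ∀ G₁ G₂ {k} → length G₁ ≡ suc k → length G₂ ≡ suc k →
               (∀ t → autocorr G₁ t ≈ autocorr G₂ t) → (recip G₁ · G₁) ≈ₚ (recip G₂ · G₂)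
  recip-·-≈ₚ G₁ G₂ G₁≡1+k G₂≡1+k ρ₁≈ρ₂ n =
    trans (coeff-recip-· G₁ G₁≡1+k n) (trans (ρ₁≈ρ₂ _) (sym (coeff-recip-· G₂ G₂≡1+k n)))

  -- The Gram matrix of the polar form

  polar-− : ∀ {n} (φ ψ : Vec Carrier n → Carrier) x y →
            polar (λ h → φ h - ψ h) x y ≈ polar φ x y - polar ψ x y
  polar-− φ ψ x y = trans (+-congʳ (−-interchange _ _ _ _)) (−-interchange _ _ _ _)

  module Form {m : ℕ} (cs : Fin (suc m) → Carrier) where

    Qₛ : ℕ → (ℕ → Carrier) → Carrier
    Qₛ L u = sum (λ j → cs j * crossCorr L (toℕ j) u u)

    Bₛ : ℕ → (ℕ → Carrier) → (ℕ → Carrier) → Carrier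
    Bₛ L u v = sum (λ j → cs j * (crossCorr L (toℕ j) u v + crossCorr L (toℕ j) v u))

    -- Only used with e ≥ m, where e ∸ j is the true lag e − j.
    lagEntry : (ℕ → Carrier) → ℕ → Carrier
    lagEntry D e = sum (λ j → cs j * (D (e +ℕ toℕ j) + D (e ∸ toℕ j)))

    Q≡Qₛ : ∀ f → Q cs f ≡ Qₛ (length f) (coeff f)
    Q≡Qₛ f = sumFin≡sum (λ j → cs j * crossCorr (length f) (toℕ j) (coeff f) (coeff f))

    Qₛ-cong : ∀ L {u u′ : ℕ → Carrier} → (∀ n → u n ≈ u′ n) → Qₛ L u ≈ Qₛ L u′
    Qₛ-cong L u≈u′ = sum-cong-≋ (λ j → *-congˡ {cs j} (crossCorr-cong L (toℕ j) u≈u′ u≈u′))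

    Bₛ-cong : ∀ L {u u′ v v′ : ℕ → Carrier} → (∀ n → u n ≈ u′ n) → (∀ n → v n ≈ v′ n) →
              Bₛ L u v ≈ Bₛ L u′ v′
    Bₛ-cong L u≈u′ v≈v′ = sum-cong-≋ (λ j →
      *-congˡ {cs j} (+-cong (crossCorr-cong L (toℕ j) u≈u′ v≈v′) (crossCorr-cong L (toℕ j) v≈v′ u≈u′)))

    Qₛ-+ : ∀ L (u v : ℕ → Carrier) → Qₛ L (λ n → u n + v n) ≈ (Qₛ L u + Qₛ L v) + Bₛ L u v
    Qₛ-+ L u v = begin
      Qₛ L (λ n → u n + v n)               ≈⟨ sum-cong-≋ term-+ ⟩
      sum (λ j → (uu j + vv j) + uv j)     ≈⟨ ∑-distrib-+ (λ j → uu j + vv j) uv ⟩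
      sum (λ j → uu j + vv j) + Bₛ L u v   ≈⟨ +-congʳ (∑-distrib-+ uu vv) ⟩
      (Qₛ L u + Qₛ L v) + Bₛ L u v         ∎
      where
      W : Fin (suc m) → (ℕ → Carrier) → (ℕ → Carrier) → Carrier
      W j = crossCorr L (toℕ j)
      uu vv uv : Fin (suc m) → Carrier
      uu j = cs j * W j u u
      vv j = cs j * W j v v
      uv j = cs j * (W j u v + W j v u)
      term-+ : ∀ j → cs j * W j (λ n → u n + v n) (λ n → u n + v n) ≈ (uu j + vv j) + uv j
      term-+ j = trans (*-congˡ (crossCorr-+ L (toℕ j) u v)) (trans (distribˡ _ _ _) (+-congʳ (distribˡ _ _ _)))

    lagEntry-− : ∀ (D₁ D₂ : ℕ → Carrier) e →
                 lagEntry (λ t → D₁ t - D₂ t) e ≈ lagEntry D₁ e - lagEntry D₂ e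
    lagEntry-− D₁ D₂ e = trans (sum-cong-≋ term-−) (∑-distrib-− (term D₁) (term D₂))
      where
      term : (ℕ → Carrier) → Fin (suc m) → Carrier
      term D j = cs j * (D (e +ℕ toℕ j) + D (e ∸ toℕ j))
      term-− : ∀ j → term (λ t → D₁ t - D₂ t) j ≈ term D₁ j - term D₂ j
      term-− j = trans (*-congˡ (sym (+-−-interchange (D₁ (e +ℕ toℕ j)) (D₁ (e ∸ toℕ j))
                                                      (D₂ (e +ℕ toℕ j)) (D₂ (e ∸ toℕ j)))))
                       (x[y-z]≈xy-xz (cs j) _ _)

    polar-Q· : ∀ G {N} (x y : Vec Carrier N) →
               polar (λ h → Q cs (toList h · G)) x y
               ≈ Bₛ (N +ℕ length G) (coeff (toList x · G)) (coeff (toList y · G))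
    polar-Q· G {N} x y = trans (+-congʳ (+-congʳ Q-zipWith)) (+-+-−-cancel _ _ _)
      where
      L = N +ℕ length G
      c[_] : Vec Carrier N → ℕ → Carrier
      c[ h ] = coeff (toList h · G)
      length-h·G : ∀ h → length (toList h · G) ≡ L
      length-h·G h = ≡.trans (length-· (toList h) G) (≡.cong (_+ℕ length G) (length-toList h))
      Q-· : ∀ h → Q cs (toList h · G) ≡ Qₛ L c[ h ]
      Q-· h = ≡.trans (Q≡Qₛ (toList h · G)) (≡.cong (λ K → Qₛ K c[ h ]) (length-h·G h))
      Q-zipWith : Q cs (toList (zipWith _+_ x y) · G)
                  ≈ (Q cs (toList x · G) + Q cs (toList y · G)) + Bₛ L c[ x ] c[ y ]
      Q-zipWith = begin
        Q cs (toList (zipWith _+_ x y) · G)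
          ≡⟨ Q-· (zipWith _+_ x y) ⟩
        Qₛ L c[ zipWith _+_ x y ]
          ≈⟨ Qₛ-cong L (·-distribʳ-coeff (toList (zipWith _+_ x y)) (toList x) (toList y) G (coeff-zipWith x y)) ⟩
        Qₛ L (λ n → c[ x ] n + c[ y ] n)
          ≈⟨ Qₛ-+ L c[ x ] c[ y ] ⟩
        (Qₛ L c[ x ] + Qₛ L c[ y ]) + Bₛ L c[ x ] c[ y ]
          ≡⟨ ≡.cong₂ (λ a b → (a + b) + Bₛ L c[ x ] c[ y ]) (≡.sym (Q-· x)) (≡.sym (Q-· y)) ⟩
        (Q cs (toList x · G) + Q cs (toList y · G)) + Bₛ L c[ x ] c[ y ] ∎

    Bₛ-shifts : ∀ G {a e L} → m ≤ e → a +ℕ e +ℕ length G ≤ L →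
                Bₛ L (shift a (coeff G)) (shift (a +ℕ e) (coeff G)) ≈ lagEntry (autocorr G) e
    Bₛ-shifts G {a} {e} {L} m≤e a+e+G≤L = sum-cong-≋ (λ j →
      *-congˡ {cs j} (+-cong (forward (toℕ j)) (backward (toℕ j) (ℕ.≤-trans (Fin.toℕ≤pred[n] j) m≤e))))
      where
      γ = coeff G
      rearrange₁ : ∀ x y z → x +ℕ (y +ℕ z) ≡ z +ℕ (x +ℕ y)
      rearrange₁ = solve-∀
      rearrange₂ : ∀ x y z → x +ℕ y +ℕ z ≡ y +ℕ (z +ℕ x)
      rearrange₂ = solve-∀
      forward : ∀ j → crossCorr L j (shift a γ) (shift (a +ℕ e) γ) ≈ autocorr G (e +ℕ j)
      forward j = trans (crossCorr-shift L j (a +ℕ e) (shift a γ) γ) (dot-shift G {a} (rearrange₁ a e j) bound)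
        where
        bound : j +ℕ (a +ℕ e) +ℕ length G ≤ j +ℕ L
        bound = ≡.subst (_≤ j +ℕ L) (≡.sym (ℕ.+-assoc j (a +ℕ e) (length G))) (ℕ.+-monoʳ-≤ j a+e+G≤L)
      backward : ∀ j → j ≤ e → crossCorr L j (shift (a +ℕ e) γ) (shift a γ) ≈ autocorr G (e ∸ j)
      backward j j≤e = trans (crossCorr-shift L j a (shift (a +ℕ e) γ) γ)
                             (trans (dot-comm (j +ℕ L) _ _) (dot-shift G {j +ℕ a} lag bound))
        where
        lag : j +ℕ a +ℕ (e ∸ j) ≡ a +ℕ e
        lag = ≡.trans (rearrange₂ j a (e ∸ j)) (≡.cong (a +ℕ_) (ℕ.m∸n+n≡m j≤e))
        bound : a +ℕ e +ℕ length G ≤ j +ℕ L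
        bound = ℕ.≤-trans a+e+G≤L (ℕ.m≤n+m L j)

    gram-Φ : ∀ G₁ G₂ {i} (a b : Fin (suc i)) e → toℕ b ≡ toℕ a +ℕ e → m ≤ e →
             gram (polar (Φ {m} {i} cs G₁ G₂)) a b ≈ lagEntry (λ t → autocorr G₁ t - autocorr G₂ t) e
    gram-Φ G₁ G₂ {i} a b e b≡a+e m≤e = begin
      polar (Φ cs G₁ G₂) (basis a) (basis b)
        ≈⟨ polar-− (Q· G₁) (Q· G₂) (basis a) (basis b) ⟩
      polar (Q· G₁) (basis a) (basis b) - polar (Q· G₂) (basis a) (basis b)
        ≈⟨ +-cong (entry G₁) (-‿cong (entry G₂)) ⟩
      lagEntry (autocorr G₁) e - lagEntry (autocorr G₂) e
        ≈⟨ lagEntry-− (autocorr G₁) (autocorr G₂) e ⟨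
      lagEntry (λ t → autocorr G₁ t - autocorr G₂ t) e ∎
      where
      Q· : Poly → Vec Carrier (suc i) → Carrier
      Q· G h = Q cs (toList h · G)
      entry : ∀ G → polar (Q· G) (basis a) (basis b) ≈ lagEntry (autocorr G) e
      entry G = begin
        polar (Q· G) (basis a) (basis b)
          ≈⟨ polar-Q· G (basis a) (basis b) ⟩
        Bₛ L (coeff (toList (basis a) · G)) (coeff (toList (basis b) · G))
          ≈⟨ Bₛ-cong L (coeff-basis-· a G) (coeff-basis-· b G) ⟩
        Bₛ L (shift (toℕ a) γ) (shift (toℕ b) γ)
          ≡⟨ ≡.cong (λ n → Bₛ L (shift (toℕ a) γ) (shift n γ)) b≡a+e ⟩
        Bₛ L (shift (toℕ a) γ) (shift (toℕ a +ℕ e) γ)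
          ≈⟨ Bₛ-shifts G m≤e (ℕ.+-monoˡ-≤ (length G) a+e≤i) ⟩
        lagEntry (autocorr G) e ∎
        where
        γ = coeff G
        L = suc i +ℕ length G
        a+e≤i : toℕ a +ℕ e ≤ suc i
        a+e≤i = ≡.subst (_≤ suc i) b≡a+e (ℕ.<⇒≤ (Fin.toℕ<n b))

    lagPair-vanish : ∀ {D : ℕ → Carrier} {k′ e j} → (∀ t → k′ < t → D t ≈ 0#) → k′ +ℕ j < e →
                     D (e +ℕ j) + D (e ∸ j) ≈ 0#
    lagPair-vanish {D} {k′} {e} {j} D-vanish k′+j<e =
      trans (+-cong (D-vanish _ k′<e+j) (D-vanish _ k′<e∸j)) (+-identityʳ 0#)
      where
      k′<e∸j : k′ < e ∸ j
      k′<e∸j = ℕ.m+n≤o⇒m≤o∸n (suc k′) k′+j<e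
      k′<e+j : k′ < e +ℕ j
      k′<e+j = ℕ.≤-trans k′<e∸j (ℕ.≤-trans (ℕ.m∸n≤m e j) (ℕ.m≤m+n e j))

    lagEntry-vanish : ∀ {D : ℕ → Carrier} {k′ e} → (∀ t → k′ < t → D t ≈ 0#) → m +ℕ k′ < e →
                      lagEntry D e ≈ 0#
    lagEntry-vanish {D} {k′} {e} D-vanish m+k′<e =
      ∑-zero (λ j → y≈0⇒x*y≈0 (cs j) (lagPair-vanish {D} D-vanish (k′+j<e j)))
      where
      k′+j<e : ∀ j → k′ +ℕ toℕ j < e
      k′+j<e j = ℕ.≤-<-trans (ℕ.≤-trans (ℕ.+-monoʳ-≤ k′ (Fin.toℕ≤pred[n] j)) (ℕ.≤-reflexive (ℕ.+-comm k′ m)))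
                             m+k′<e

    lagEntry-top : ∀ {D : ℕ → Carrier} {k′} → (∀ t → k′ < t → D t ≈ 0#) →
                   lagEntry D (m +ℕ k′) ≈ cs (fromℕ m) * (D (m +ℕ k′ +ℕ m) + D k′)
    lagEntry-top {D} {k′} D-vanish = begin
      lagEntry D d
        ≈⟨ sum-init-last term ⟩
      sum (λ j → term (inject₁ j)) + term (fromℕ m)
        ≈⟨ +-congʳ (∑-zero (λ j → y≈0⇒x*y≈0 (cs (inject₁ j)) (lagPair-vanish {D} D-vanish (below j)))) ⟩
      0# + term (fromℕ m)
        ≈⟨ +-identityˡ _ ⟩
      term (fromℕ m)
        ≡⟨ ≡.cong₂ (λ x y → cs (fromℕ m) * (D (d +ℕ x) + D y)) (Fin.toℕ-fromℕ m)
                   (≡.trans (≡.cong (d ∸_) (Fin.toℕ-fromℕ m)) (ℕ.m+n∸m≡n m k′)) ⟩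
      cs (fromℕ m) * (D (d +ℕ m) + D k′) ∎
      where
      d = m +ℕ k′
      term : Fin (suc m) → Carrier
      term j = cs j * (D (d +ℕ toℕ j) + D (d ∸ toℕ j))
      below : ∀ (j : Fin m) → k′ +ℕ toℕ (inject₁ j) < d
      below j = ≡.subst (λ x → k′ +ℕ x < d) (≡.sym (Fin.toℕ-inject₁ j))
                        (≡.subst (k′ +ℕ toℕ j <_) (ℕ.+-comm k′ m) (ℕ.+-monoʳ-< k′ (Fin.toℕ<n j)))

  -- Finite fields and the rank bound

  module FiniteField {q : ℕ} (𝔽 : IsFiniteFieldOfOrder q) where
    open IsFiniteFieldOfOrder 𝔽
    open import Algebra.Properties.Semiring.Sum semiring using (sum-permute; sum-replicate)
    open import Algebra.Properties.Semiring.Mult semiring using (×1-homo-*) renaming (_×_ to _×′_)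
    open import Data.Fin.Permutation using (Permutation; permutation)

    _≈?_ : Decidable _≈_
    x ≈? y = map′ toFin-injective toFin-cong (toFin x Fin.≟ toFin y)
      where
      toFin-injective : toFin x ≡ toFin y → x ≈ y
      toFin-injective eq = trans (sym (from-to x)) (trans (reflexive (≡.cong fromFin eq)) (from-to y))

    x*y≈0⇒x≈0 : ∀ {x y} → ¬ y ≈ 0# → x * y ≈ 0# → x ≈ 0#
    x*y≈0⇒x≈0 {x} {y} y≉0 xy≈0 with inverse y y≉0
    ... | y⁻¹ , yy⁻¹≈1 = begin
      x             ≈⟨ *-identityʳ x ⟨
      x * 1#        ≈⟨ *-congˡ yy⁻¹≈1 ⟨
      x * (y * y⁻¹) ≈⟨ *-assoc x y y⁻¹ ⟨
      (x * y) * y⁻¹ ≈⟨ *-congʳ xy≈0 ⟩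
      0# * y⁻¹      ≈⟨ zeroˡ y⁻¹ ⟩
      0#            ∎

    *-≉0 : ∀ {x y} → ¬ x ≈ 0# → ¬ y ≈ 0# → ¬ x * y ≈ 0#
    *-≉0 x≉0 y≉0 xy≈0 = x≉0 (x*y≈0⇒x≈0 y≉0 xy≈0)

    translate : Carrier → Fin q → Fin q
    translate x i = toFin (fromFin i + x)

    translate-inverse : ∀ {x y} → x + y ≈ 0# → ∀ i → translate y (translate x i) ≡ i
    translate-inverse {x} {y} x+y≈0 i = ≡.trans (toFin-cong (begin
      fromFin (toFin (fromFin i + x)) + y ≈⟨ +-congʳ (from-to _) ⟩
      (fromFin i + x) + y                 ≈⟨ +-assoc _ x y ⟩
      fromFin i + (x + y)                 ≈⟨ +-congˡ x+y≈0 ⟩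
      fromFin i + 0#                      ≈⟨ +-identityʳ _ ⟩
      fromFin i                           ∎)) (to-from i)

    -- Translation by x permutes the field, so the sum S of all its elements satisfies S ≈ S + q x.
    q×x≈0 : ∀ x → q ×′ x ≈ 0#
    q×x≈0 x = +-identityʳ-unique S (q ×′ x) (sym (begin
      S                                   ≈⟨ sum-permute fromFin π ⟩
      sum (λ i → fromFin (translate x i)) ≈⟨ sum-cong-≋ (λ i → from-to (fromFin i + x)) ⟩
      sum (λ i → fromFin i + x)           ≈⟨ ∑-distrib-+ {q} fromFin (λ _ → x) ⟩
      S + sum {q} (λ _ → x)               ≈⟨ +-congˡ (sum-replicate q) ⟩
      S + q ×′ x                          ∎))
      where
      S = sum fromFin
      π : Permutation q q
      π = permutation (translate x) (translate (- x))
                      (translate-inverse (-‿inverseˡ x)) (translate-inverse (-‿inverseʳ x))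

    1+1≉0 : ¬ (∃[ r ] q ≡ 2 *ℕ r) → ¬ 1# + 1# ≈ 0#
    1+1≉0 q-odd 1+1≈0 = 1≉0 (begin
      1#                    ≈⟨ +-identityʳ 1# ⟨
      1# + 0#               ≈⟨ +-congˡ (trans (×1-homo-* r 2) (y≈0⇒x*y≈0 (r ×′ 1#) 2×1≈0)) ⟨
      1# + (r *ℕ 2) ×′ 1#   ≡⟨ ≡.cong (_×′ 1#) (odd⇒≡1+[n/2]*2 q-odd) ⟨
      q ×′ 1#               ≈⟨ q×x≈0 1# ⟩
      0#                    ∎)
      where
      r = q / 2
      2×1≈0 : 2 ×′ 1# ≈ 0#
      2×1≈0 = trans (+-congˡ (+-identityʳ 1#)) 1+1≈0

    triangular⇒independent : ∀ {n r} (M : Fin n → Fin n → Carrier) (rows cols : Fin r → Fin n) →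
                             (∀ {j s} → toℕ s < toℕ j → M (rows j) (cols s) ≈ 0#) →
                             (∀ s → ¬ M (rows s) (cols s) ≈ 0#) →
                             ∀ (λs : Fin r → Carrier) → (∀ b → sumFin (λ j → λs j * M (rows j) b) ≈ 0#) →
                             ∀ j → λs j ≈ 0#
    triangular⇒independent {r = zero}  _ _ _ _ _ _ _ ()
    triangular⇒independent {n} {suc r} M rows cols below pivot λs combo≈0 = vanish
      where
      rest : Fin n → Carrier
      rest b = sumFin (λ j → λs (suc j) * M (rows (suc j)) b)
      rest≈0-at-first-pivot : rest (cols zero) ≈ 0#
      rest≈0-at-first-pivot = sumFin-zero (λ j → y≈0⇒x*y≈0 (λs (suc j)) (below {suc j} (s≤s z≤n)))
      λ₀≈0 : λs zero ≈ 0#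
      λ₀≈0 = x*y≈0⇒x≈0 (pivot zero) (begin
        λs zero * M (rows zero) (cols zero)                     ≈⟨ +-identityʳ _ ⟨
        λs zero * M (rows zero) (cols zero) + 0#                ≈⟨ +-congˡ rest≈0-at-first-pivot ⟨
        λs zero * M (rows zero) (cols zero) + rest (cols zero)  ≈⟨ combo≈0 (cols zero) ⟩
        0#                                                      ∎)
      rest≈0 : ∀ b → rest b ≈ 0#
      rest≈0 b = begin
        rest b                              ≈⟨ +-identityˡ _ ⟨
        0# + rest b                         ≈⟨ +-congʳ (x≈0⇒x*y≈0 (M (rows zero) b) λ₀≈0) ⟨
        λs zero * M (rows zero) b + rest b  ≈⟨ combo≈0 b ⟩
        0#                                  ∎
      vanish : ∀ j → λs j ≈ 0#
      vanish zero    = λ₀≈0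
      vanish (suc j) = triangular⇒independent M (rows ∘ suc) (cols ∘ suc) (λ s<j → below (s≤s s<j))
                                              (pivot ∘ suc) (λs ∘ suc) rest≈0 j

    triangular⇒RankAtLeast : ∀ {n r} (M : Fin n → Fin n → Carrier) (rows cols : Fin r → Fin n) →
                             (∀ {j s} → toℕ s < toℕ j → M (rows j) (cols s) ≈ 0#) →
                             (∀ s → ¬ M (rows s) (cols s) ≈ 0#) →
                             RankAtLeast M r
    triangular⇒RankAtLeast M rows cols below pivot = rows , triangular⇒independent M rows cols below pivot

    module Rank {m} (cs : Fin (suc m) → Carrier) (cₘ≉0 : ¬ cs (fromℕ m) ≈ 0#) (1+1≉0 : ¬ 1# + 1# ≈ 0#)
                (G₁ G₂ : Poly) (i k′ : ℕ) (disagree : ¬ autocorr G₁ k′ ≈ autocorr G₂ k′)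
                (agree : ∀ t → k′ < t → autocorr G₁ t ≈ autocorr G₂ t) where
      open Form cs

      D : ℕ → Carrier
      D t = autocorr G₁ t - autocorr G₂ t

      d : ℕ
      d = m +ℕ k′

      M : Fin (suc i) → Fin (suc i) → Carrier
      M = gram (polar (Φ {m} {i} cs G₁ G₂))

      D-vanish : ∀ t → k′ < t → D t ≈ 0#
      D-vanish t k′<t = x≈y⇒x∙y⁻¹≈ε (agree t k′<t)

      D-top : ¬ D k′ ≈ 0#
      D-top = disagree ∘ x∙y⁻¹≈ε⇒x≈y _ _

      -- For m = 0 the two lags coincide and the pair is 2 D(k′); this is where q odd is needed.
      lagPair-top≉0 : ¬ D (d +ℕ m) + D k′ ≈ 0#
      lagPair-top≉0 with m ℕ.≟ 0
      ... | yes m≡0 = *-≉0 1+1≉0 D-top ∘ trans doubled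
        where
        d+m≡k′ : d +ℕ m ≡ k′
        d+m≡k′ = ≡.subst (λ x → x +ℕ k′ +ℕ x ≡ k′) (≡.sym m≡0) (ℕ.+-identityʳ k′)
        doubled : (1# + 1#) * D k′ ≈ D (d +ℕ m) + D k′
        doubled = trans (distribʳ _ _ _)
                        (+-cong (trans (*-identityˡ _) (reflexive (≡.cong D (≡.sym d+m≡k′)))) (*-identityˡ _))
      ... | no m≢0  = D-top ∘ trans (sym (trans (+-congʳ (D-vanish _ k′<d+m)) (+-identityˡ _)))
        where
        k′<d+m : k′ < d +ℕ m
        k′<d+m = ℕ.≤-trans (ℕ.m<n+m k′ (ℕ.n≢0⇒n>0 m≢0)) (ℕ.m≤m+n d m)

      gram-beyond-band : ∀ a b → toℕ a +ℕ d < toℕ b → M a b ≈ 0#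
      gram-beyond-band a b a+d<b = begin
        M a b                       ≈⟨ gram-Φ G₁ G₂ a b (toℕ b ∸ toℕ a) (≡.sym (ℕ.m+[n∸m]≡n a≤b)) m≤b∸a ⟩
        lagEntry D (toℕ b ∸ toℕ a)  ≈⟨ lagEntry-vanish D-vanish d<b∸a ⟩
        0#                          ∎
        where
        a≤b : toℕ a ≤ toℕ b
        a≤b = ℕ.≤-trans (ℕ.m≤m+n (toℕ a) d) (ℕ.<⇒≤ a+d<b)
        d<b∸a : d < toℕ b ∸ toℕ a
        d<b∸a = ℕ.m+n≤o⇒m≤o∸n (suc d) (≡.subst (λ x → suc x ≤ toℕ b) (ℕ.+-comm (toℕ a) d) a+d<b)
        m≤b∸a : m ≤ toℕ b ∸ toℕ a
        m≤b∸a = ℕ.≤-trans (ℕ.m≤m+n m k′) (ℕ.<⇒≤ d<b∸a)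

      gram-band-edge : ∀ a b → toℕ b ≡ toℕ a +ℕ d → ¬ M a b ≈ 0#
      gram-band-edge a b b≡a+d M≈0 = *-≉0 cₘ≉0 lagPair-top≉0 (begin
        cs (fromℕ m) * (D (d +ℕ m) + D k′) ≈⟨ lagEntry-top D-vanish ⟨
        lagEntry D d                        ≈⟨ gram-Φ G₁ G₂ a b d b≡a+d (ℕ.m≤m+n m k′) ⟨
        M a b                               ≈⟨ M≈0 ⟩
        0#                                  ∎)

      -- Rows are taken in decreasing order, so that each pivot column is zero in all later rows.
      polarRank : ∀ r → r ≤ suc i ∸ d → PolarRankAtLeast (Φ {m} {i} cs G₁ G₂) r
      polarRank r r≤1+i∸d = triangular⇒RankAtLeast M rows cols below pivot
        where
        row : Fin r → ℕ
        row j = toℕ (opposite j)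
        row+d<1+i : ∀ j → row j +ℕ d < suc i
        row+d<1+i j = m<o∸n⇒m+n<o (ℕ.<-≤-trans (Fin.toℕ<n (opposite j)) r≤1+i∸d)
        row<1+i : ∀ j → row j < suc i
        row<1+i j = ℕ.≤-<-trans (ℕ.m≤m+n (row j) d) (row+d<1+i j)
        rows cols : Fin r → Fin (suc i)
        rows j = fromℕ< (row<1+i j)
        cols j = fromℕ< (row+d<1+i j)
        row-anti : ∀ {j s} → toℕ s < toℕ j → row j < row s
        row-anti {j} {s} s<j = ≡.subst₂ _<_ (≡.sym (Fin.opposite-prop j)) (≡.sym (Fin.opposite-prop s))
                                         (ℕ.∸-monoʳ-< (s≤s s<j) (Fin.toℕ<n j))
        toℕ-rows : ∀ j → toℕ (rows j) ≡ row j
        toℕ-rows j = Fin.toℕ-fromℕ< (row<1+i j)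
        toℕ-cols : ∀ j → toℕ (cols j) ≡ row j +ℕ d
        toℕ-cols j = Fin.toℕ-fromℕ< (row+d<1+i j)
        below : ∀ {j s} → toℕ s < toℕ j → M (rows j) (cols s) ≈ 0#
        below {j} {s} s<j = gram-beyond-band (rows j) (cols s)
          (≡.subst₂ (λ x y → x +ℕ d < y) (≡.sym (toℕ-rows j)) (≡.sym (toℕ-cols s)) (ℕ.+-monoˡ-< d (row-anti s<j)))
        pivot : ∀ s → ¬ M (rows s) (cols s) ≈ 0#
        pivot s = gram-band-edge (rows s) (cols s) (≡.trans (toℕ-cols s) (≡.cong (_+ℕ d) (≡.sym (toℕ-rows s))))

open import Data.Nat.Base using (_+_)

lemma4p1 : ∀ {c ℓ : Level} (F : CommutativeRing c ℓ) (q : ℕ)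
             → OddPrimePower q
             → Over.IsFiniteFieldOfOrder F q
             → (m : ℕ) (cs : Fin (suc m) → CommutativeRing.Carrier F)
             → ¬ (CommutativeRing._≈_ F (cs (fromℕ m)) (CommutativeRing.0# F))
             → (k i : ℕ) (g₁ g₂ : Vec (CommutativeRing.Carrier F) k)
             → ¬ (Over._≈ₚ_ F (Over._·_ F (Over.recip F (Over.monic F g₁)) (Over.monic F g₁))
                              (Over._·_ F (Over.recip F (Over.monic F g₂)) (Over.monic F g₂)))
             → Over.PolarRankAtLeast F {suc i}
                 (Over.Φ F {m} {i} cs (Over.monic F g₁) (Over.monic F g₂))
                 (suc i ∸ (k + m))
lemma4p1 F q (_ , _ , _ , _ , q-odd) 𝔽 m cs cₘ≉0 k i g₁ g₂ g₁*g₁≉g₂*g₂ =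
  let k′ , k′<1+k , disagree , agree =
        lastFailure (λ t → autocorr G₁ t ≈? autocorr G₂ t) (suc k) ρ₁≈ρ₂-beyond-k ρ₁≉ρ₂
  in Rank.polarRank cs cₘ≉0 (1+1≉0 q-odd) G₁ G₂ i k′ disagree agree
                    (suc i ∸ (k + m)) (ℕ.∸-monoʳ-≤ (suc i) (lag-bound k′<1+k))
  where
  open CommutativeRing F using (_≈_; trans; sym)
  open Over F using (Poly; monic)
  open Polar F
  open FiniteField 𝔽
  G₁ G₂ : Poly
  G₁ = monic g₁
  G₂ = monic g₂
  ρ₁≈ρ₂-beyond-k : ∀ t → suc k ≤ t → autocorr G₁ t ≈ autocorr G₂ t
  ρ₁≈ρ₂-beyond-k t k<t = trans (autocorr-beyond G₁ (≡.subst (_≤ t) (≡.sym (length-monic g₁)) k<t))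
                               (sym (autocorr-beyond G₂ (≡.subst (_≤ t) (≡.sym (length-monic g₂)) k<t)))
  ρ₁≉ρ₂ : ¬ (∀ t → autocorr G₁ t ≈ autocorr G₂ t)
  ρ₁≉ρ₂ = g₁*g₁≉g₂*g₂ ∘ recip-·-≈ₚ G₁ G₂ (length-monic g₁) (length-monic g₂)
  lag-bound : ∀ {k′} → k′ < suc k → m + k′ ≤ k + m
  lag-bound k′<1+k = ℕ.≤-trans (ℕ.+-monoʳ-≤ m (ℕ.≤-pred k′<1+k)) (ℕ.≤-reflexive (ℕ.+-comm m k))
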